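{- Let $T$ be a threshold graph with clique number $d$, clique vector $\mathfrak{c}(T)=(c_1,\ldots,c_d)$ and $b$-vector $\mathfrak{b}(T)=(b_1,\ldots,b_d)$. Then \[ \sum_{i=1}^d b_i(x+1)^{i-1}=\sum_{i=1}^d c_i x^{i-1}. \]
   Context: All graphs are finite and simple. For a graph $G$, $S(G)$ is obtained from $G$ by adding a new vertex adjacent to all vertices of $G$, and $D(G)$ is obtained by adding a new isolated vertex. A threshold graph is one obtainable from the null graph $\emptyset$ by a sequence of $S$- and $D$-operations; it corresponds bijectively to a word $w_1\cdots w_m$ on $\{S,D\}$ with $w_m=S$, meaning $T=w_1(w_2(\cdots w_m(\emptyset)\cdots))$. The clique number $d$ of $T$ equals the number of letters $S$ in its word. The $b$-vector of $T$: insert a separator immediately after every occurrence of $S$ in the word, splitting it into $d$ consecutive subwords (each ending in $S$); $b_i$ is the length of the $i$-th subword from the left. For example, $DDDSSDSDDS$ splits as $DDDS/S/DS/DDS$, giving $\mathfrak{b}=(4,1,2,3)$. The clique vector is $(c_1,\ldots,c_d)$ where $c_i$ is the number of cliques of $T$ with $i$ vertices. -}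

module Defs where

open import Data.Bool using (Bool; true; false; _∧_; if_then_else_; not)
open import Data.Nat using (ℕ; zero; suc; _+_; _*_; _<ᵇ_; _≡ᵇ_)
open import Data.Fin using (Fin; toℕ)
open import Data.List using (List; []; _∷_; length; lookup; map; upTo; allFin; filterᵇ; _++_)
open import Data.Vec using (Vec; []; _∷_)
open import Data.Fin.Subset using (Subset; ∣_∣; inside)

record Graph : Set where
  field
    order : ℕ
    adj   : Fin order → Fin order → Bool

open Graph public

allSubsets : (n : ℕ) → List (Subset n)
allSubsets zero    = [] ∷ []
allSubsets (suc n) = map (true ∷_) (allSubsets n) ++ map (false ∷_) (allSubsets n)

memb : ∀ {n} → Fin n → Subset n → Bool
memb Fin.zero    (b ∷ _) = b
memb (Fin.suc i) (_ ∷ p) = memb i p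

allB : ∀ {A : Set} → (A → Bool) → List A → Bool
allB f []       = true
allB f (x ∷ xs) = f x ∧ allB f xs

isClique : (G : Graph) → Subset (order G) → Bool
isClique G p =
  allB (λ i → allB (λ j →
        if memb i p ∧ memb j p ∧ not (toℕ i ≡ᵇ toℕ j)
        then adj G i j else true) (allFin (order G))) (allFin (order G))

cliqueCount : Graph → ℕ → ℕ
cliqueCount G k =
  length (filterᵇ (λ p → isClique G p ∧ (∣ p ∣ ≡ᵇ k)) (allSubsets (order G)))

data Letter : Set where
  S D : Letter

isS : Letter → Bool
isS S = true
isS D = false

-- T = w₁(w₂(⋯ wₘ(∅)⋯)); vertex i (0-based position in the word) is the
-- vertex created by letter wᵢ₊₁.  Letters further left are applied later,
-- so for positions i < j the vertex of i is adjacent to that of j iff wᵢ = S.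
thresholdGraph : List Letter → Graph
thresholdGraph w = record
  { order = length w
  ; adj   = λ i j →
      if toℕ i <ᵇ toℕ j then isS (lookup w i)
      else if toℕ j <ᵇ toℕ i then isS (lookup w j)
      else false
  }

-- number of letters S (= clique number d)
numS : List Letter → ℕ
numS []      = 0
numS (S ∷ w) = suc (numS w)
numS (D ∷ w) = numS w

-- b-vector: lengths of the subwords obtained by cutting after each S
bVecAux : ℕ → List Letter → List ℕ
bVecAux acc []      = []
bVecAux acc (D ∷ w) = bVecAux (suc acc) w
bVecAux acc (S ∷ w) = suc acc ∷ bVecAux 0 w

bVec : List Letter → List ℕ
bVec = bVecAux 0

cliqueVec : List Letter → List ℕ
cliqueVec w = map (λ i → cliqueCount (thresholdGraph w) (suc i)) (upTo (numS w))

evalPoly : List ℕ → ℕ → ℕ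
evalPoly []       y = 0
evalPoly (a ∷ as) y = a + y * evalPoly as y

-- Both sides equal Φ_w(x), where Φ_{Sw} = 1 + (x+1) Φ_w and Φ_{Dw} = 1 + Φ_w.
-- For the b-vector this is Horner's scheme read along the word.  For cliques,
-- a vertex added by S joins every clique of the rest (Pascal: c'_{k+1} = c_k + c_{k+1}),
-- while a vertex added by D only adds one clique of size 1; the truncation of the
-- clique vector at d is harmless because a word ending in S has no cliques above d.
module Submission where

open import Defs
open import Data.Bool using (Bool; true; false; _∧_; not; if_then_else_)
open import Data.Fin using (Fin; toℕ) renaming (zero to fzero; suc to fsuc)
open import Data.Fin.Subset using (Subset; ∣_∣)
open import Data.List using (List; []; _∷_; _++_; map; length; filterᵇ; tabulate; applyUpTo; last)
open import Data.Maybe using (just)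
open import Data.Nat using (ℕ; zero; suc; _+_; _*_; _≤_; _≡ᵇ_; s≤s; z≤n)
open import Data.Nat.Properties
  using (+-comm; +-suc; *-distribˡ-+; *-zeroʳ; m≤n⇒m≤1+n; +-commutativeSemigroup)
open import Algebra.Properties.CommutativeSemigroup +-commutativeSemigroup using (interchange)
open import Data.Vec using ([]; _∷_)
open import Relation.Binary.PropositionalEquality

countᵇ : {A : Set} → (A → Bool) → List A → ℕ
countᵇ p []       = 0
countᵇ p (x ∷ xs) = if p x then suc (countᵇ p xs) else countᵇ p xs

module _ {A : Set} where

  length-filterᵇ : (p : A → Bool) (xs : List A) → length (filterᵇ p xs) ≡ countᵇ p xs
  length-filterᵇ p []       = refl
  length-filterᵇ p (x ∷ xs) with p x
  ... | true  = cong suc (length-filterᵇ p xs)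
  ... | false = length-filterᵇ p xs

  countᵇ-++ : (p : A → Bool) (xs ys : List A) → countᵇ p (xs ++ ys) ≡ countᵇ p xs + countᵇ p ys
  countᵇ-++ p []       ys = refl
  countᵇ-++ p (x ∷ xs) ys with p x
  ... | true  = cong suc (countᵇ-++ p xs ys)
  ... | false = countᵇ-++ p xs ys

  countᵇ-map : {B : Set} (p : B → Bool) (f : A → B) (xs : List A) →
               countᵇ p (map f xs) ≡ countᵇ (λ a → p (f a)) xs
  countᵇ-map p f []       = refl
  countᵇ-map p f (x ∷ xs) with p (f x)
  ... | true  = cong suc (countᵇ-map p f xs)
  ... | false = countᵇ-map p f xs

  countᵇ-cong : {p q : A → Bool} → (∀ a → p a ≡ q a) → (xs : List A) → countᵇ p xs ≡ countᵇ q xs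
  countᵇ-cong             p≗q []       = refl
  countᵇ-cong {q = q} p≗q (x ∷ xs) rewrite p≗q x with q x
  ... | true  = cong suc (countᵇ-cong p≗q xs)
  ... | false = countᵇ-cong p≗q xs

  countᵇ-none : {p : A → Bool} → (∀ a → p a ≡ false) → (xs : List A) → countᵇ p xs ≡ 0
  countᵇ-none p≗false []       = refl
  countᵇ-none p≗false (x ∷ xs) rewrite p≗false x = countᵇ-none p≗false xs

countᵇ-allSubsets : ∀ m (p : Subset (suc m) → Bool) →
  countᵇ p (allSubsets (suc m)) ≡
  countᵇ (λ q → p (true ∷ q)) (allSubsets m) + countᵇ (λ q → p (false ∷ q)) (allSubsets m)
countᵇ-allSubsets m p = trans (countᵇ-++ p (map (true ∷_) (allSubsets m)) _)
  (cong₂ _+_ (countᵇ-map p (true ∷_) (allSubsets m)) (countᵇ-map p (false ∷_) (allSubsets m)))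

allFinᵇ : (n : ℕ) → (Fin n → Bool) → Bool
allFinᵇ zero    h = true
allFinᵇ (suc n) h = h fzero ∧ allFinᵇ n (λ i → h (fsuc i))

allB-tabulate : ∀ {A : Set} n (f : A → Bool) (g : Fin n → A) →
                allB f (tabulate g) ≡ allFinᵇ n (λ i → f (g i))
allB-tabulate zero    f g = refl
allB-tabulate (suc n) f g = cong (f (g fzero) ∧_) (allB-tabulate n f (λ i → g (fsuc i)))

allFinᵇ-cong : ∀ n {h k : Fin n → Bool} → (∀ i → h i ≡ k i) → allFinᵇ n h ≡ allFinᵇ n k
allFinᵇ-cong zero    h≗k = refl
allFinᵇ-cong (suc n) h≗k = cong₂ _∧_ (h≗k fzero) (allFinᵇ-cong n (λ i → h≗k (fsuc i)))

allFinᵇ-true : ∀ n → allFinᵇ n (λ _ → true) ≡ true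
allFinᵇ-true zero    = refl
allFinᵇ-true (suc n) = allFinᵇ-true n

∧-false : ∀ b → b ∧ false ≡ false
∧-false true  = refl
∧-false false = refl

if-true-true : ∀ b → (if b then true else true) ≡ true
if-true-true true  = refl
if-true-true false = refl

cliqueCondition : (G : Graph) → Subset (order G) → Fin (order G) → Fin (order G) → Bool
cliqueCondition G p i j =
  if memb i p ∧ memb j p ∧ not (toℕ i ≡ᵇ toℕ j) then adj G i j else true

isClique-allFinᵇ : ∀ G p →
  isClique G p ≡ allFinᵇ (order G) (λ i → allFinᵇ (order G) (λ j → cliqueCondition G p i j))
isClique-allFinᵇ G p = trans (allB-tabulate (order G) _ (λ i → i))
  (allFinᵇ-cong (order G) (λ i → allB-tabulate (order G) _ (λ j → j)))

-- Vertex 0 of thresholdGraph (l ∷ w) is the vertex added last; the remaining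
-- vertices span thresholdGraph w, with conditions shifted by fsuc definitionally.
isClique-∷-irrelevant : ∀ l w b p →
  (∀ j → cliqueCondition (thresholdGraph (l ∷ w)) (b ∷ p) fzero (fsuc j) ≡ true) →
  (∀ i → cliqueCondition (thresholdGraph (l ∷ w)) (b ∷ p) (fsuc i) fzero ≡ true) →
  isClique (thresholdGraph (l ∷ w)) (b ∷ p) ≡ isClique (thresholdGraph w) p
isClique-∷-irrelevant l w b p row col = begin
  isClique (thresholdGraph (l ∷ w)) (b ∷ p)
    ≡⟨ isClique-allFinᵇ (thresholdGraph (l ∷ w)) (b ∷ p) ⟩
  (diagonal b ∧ allFinᵇ m _) ∧ allFinᵇ m (λ i → _ ∧ allFinᵇ m (cliqueCondition (thresholdGraph w) p i))
    ≡⟨ cong₂ _∧_ (cong₂ _∧_ (diagonal-true b) (trans (allFinᵇ-cong m row) (allFinᵇ-true m)))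
                 (allFinᵇ-cong m (λ i → cong (_∧ _) (col i))) ⟩
  allFinᵇ m (λ i → allFinᵇ m (cliqueCondition (thresholdGraph w) p i))
    ≡⟨ isClique-allFinᵇ (thresholdGraph w) p ⟨
  isClique (thresholdGraph w) p ∎
  where
  open ≡-Reasoning
  m = length w
  diagonal : Bool → Bool
  diagonal b = if b ∧ b ∧ false then false else true
  diagonal-true : ∀ b → diagonal b ≡ true
  diagonal-true true  = refl
  diagonal-true false = refl

isClique-false∷ : ∀ l w p → isClique (thresholdGraph (l ∷ w)) (false ∷ p) ≡ isClique (thresholdGraph w) p
isClique-false∷ l w p = isClique-∷-irrelevant l w false p (λ j → refl)
  (λ i → cong (if_then isS l else true) (∧-false (memb i p)))

isClique-S∷ : ∀ w b p → isClique (thresholdGraph (S ∷ w)) (b ∷ p) ≡ isClique (thresholdGraph w) p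
isClique-S∷ w b p = isClique-∷-irrelevant S w b p (λ j → if-true-true _) (λ i → if-true-true _)

noneᵇ : ∀ m → Subset m → Bool
noneᵇ m p = allFinᵇ m (λ j → not (memb j p))

noneᵇ-size : ∀ m (p : Subset m) → noneᵇ m p ≡ (∣ p ∣ ≡ᵇ 0)
noneᵇ-size zero    []          = refl
noneᵇ-size (suc m) (true ∷ p)  = refl
noneᵇ-size (suc m) (false ∷ p) = noneᵇ-size m p

-- A vertex added by D is adjacent to nothing, so it only forms the clique {itself}.
isClique-D∷-true∷ : ∀ w p → isClique (thresholdGraph (D ∷ w)) (true ∷ p) ≡ (∣ p ∣ ≡ᵇ 0)
isClique-D∷-true∷ w p = begin
  isClique (thresholdGraph (D ∷ w)) (true ∷ p)
    ≡⟨ isClique-allFinᵇ (thresholdGraph (D ∷ w)) (true ∷ p) ⟩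
  allFinᵇ m _ ∧ allFinᵇ m _
    ≡⟨ cong₂ _∧_ (allFinᵇ-cong m row) (allFinᵇ-cong m col) ⟩
  noneᵇ m p ∧ noneᵇ m p
    ≡⟨ ∧-idem (noneᵇ m p) ⟩
  noneᵇ m p
    ≡⟨ noneᵇ-size m p ⟩
  (∣ p ∣ ≡ᵇ 0) ∎
  where
  open ≡-Reasoning
  m = length w
  row : ∀ j → (if memb j p ∧ true then false else true) ≡ not (memb j p)
  row j with memb j p
  ... | true  = refl
  ... | false = refl
  col : ∀ i → ((if memb i p ∧ true ∧ true then false else true) ∧
               allFinᵇ m (cliqueCondition (thresholdGraph w) p i)) ≡ not (memb i p)
  col i with memb i p
  ... | true  = refl
  ... | false = allFinᵇ-true m
  ∧-idem : ∀ b → b ∧ b ≡ b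
  ∧-idem true  = refl
  ∧-idem false = refl

cliques : List Letter → ℕ → ℕ
cliques w k = countᵇ (λ p → isClique (thresholdGraph w) p ∧ (∣ p ∣ ≡ᵇ k)) (allSubsets (length w))

cliques-zero : ∀ w → cliques w 0 ≡ 1
cliques-zero []      = refl
cliques-zero (l ∷ w) = trans (countᵇ-allSubsets (length w) _)
  (cong₂ _+_ (countᵇ-none (λ q → ∧-false _) (allSubsets (length w)))
             (trans (countᵇ-cong (λ q → cong (_∧ (∣ q ∣ ≡ᵇ 0)) (isClique-false∷ l w q))
                                 (allSubsets (length w)))
                    (cliques-zero w)))

cliques-S∷ : ∀ w k → cliques (S ∷ w) (suc k) ≡ cliques w k + cliques w (suc k)
cliques-S∷ w k = trans (countᵇ-allSubsets (length w) _)
  (cong₂ _+_ (countᵇ-cong (λ q → cong (_∧ (∣ q ∣ ≡ᵇ k)) (isClique-S∷ w true q)) (allSubsets (length w)))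
             (countᵇ-cong (λ q → cong (_∧ (∣ q ∣ ≡ᵇ suc k)) (isClique-false∷ S w q)) (allSubsets (length w))))

δ₀ : ℕ → ℕ
δ₀ zero    = 1
δ₀ (suc _) = 0

countᵇ-empty-of-size : ∀ m k → countᵇ (λ (p : Subset m) → (∣ p ∣ ≡ᵇ 0) ∧ (∣ p ∣ ≡ᵇ k)) (allSubsets m) ≡ δ₀ k
countᵇ-empty-of-size zero    zero    = refl
countᵇ-empty-of-size zero    (suc k) = refl
countᵇ-empty-of-size (suc m) k       = trans (countᵇ-allSubsets m _)
  (cong₂ _+_ (countᵇ-none (λ q → refl) (allSubsets m)) (countᵇ-empty-of-size m k))

cliques-D∷ : ∀ w k → cliques (D ∷ w) (suc k) ≡ δ₀ k + cliques w (suc k)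
cliques-D∷ w k = trans (countᵇ-allSubsets (length w) _)
  (cong₂ _+_ (trans (countᵇ-cong (λ q → cong (_∧ (∣ q ∣ ≡ᵇ k)) (isClique-D∷-true∷ w q)) (allSubsets (length w)))
                    (countᵇ-empty-of-size (length w) k))
             (countᵇ-cong (λ q → cong (_∧ (∣ q ∣ ≡ᵇ suc k)) (isClique-false∷ D w q)) (allSubsets (length w))))

data EndsWithS : List Letter → Set where
  [S] : EndsWithS (S ∷ [])
  S∷_ : ∀ {w} → EndsWithS w → EndsWithS (S ∷ w)
  D∷_ : ∀ {w} → EndsWithS w → EndsWithS (D ∷ w)

last≡S⇒EndsWithS : ∀ w → last w ≡ just S → EndsWithS w
last≡S⇒EndsWithS (S ∷ [])     refl = [S]
last≡S⇒EndsWithS (S ∷ y ∷ ys) eq   = S∷ last≡S⇒EndsWithS (y ∷ ys) eq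
last≡S⇒EndsWithS (D ∷ y ∷ ys) eq   = D∷ last≡S⇒EndsWithS (y ∷ ys) eq

numS-positive : ∀ {w} → EndsWithS w → 1 ≤ numS w
numS-positive [S]    = s≤s z≤n
numS-positive (S∷ e) = s≤s z≤n
numS-positive (D∷ e) = numS-positive e

cliques-vanish : ∀ {w} → EndsWithS w → ∀ k → numS w ≤ k → cliques w (suc k) ≡ 0
cliques-vanish [S]             (suc k) _         = refl
cliques-vanish (S∷_ {w} e)     (suc k) (s≤s n≤k) = trans (cliques-S∷ w (suc k))
  (cong₂ _+_ (cliques-vanish e k n≤k) (cliques-vanish e (suc k) (m≤n⇒m≤1+n n≤k)))
cliques-vanish (D∷_ {w} e)     zero    n≤0 with numS w | numS-positive e
cliques-vanish (D∷_ {w} e)     zero    () | suc _ | _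
cliques-vanish (D∷_ {w} e)     (suc k) n≤k = trans (cliques-D∷ w (suc k)) (cliques-vanish e (suc k) n≤k)

evalSeq : (ℕ → ℕ) → ℕ → ℕ → ℕ
evalSeq c zero    x = 0
evalSeq c (suc n) x = c 0 + x * evalSeq (λ k → c (suc k)) n x

evalSeq-cong : ∀ {c d} → (∀ k → c k ≡ d k) → ∀ n x → evalSeq c n x ≡ evalSeq d n x
evalSeq-cong c≗d zero    x = refl
evalSeq-cong c≗d (suc n) x = cong₂ _+_ (c≗d 0) (cong (x *_) (evalSeq-cong (λ k → c≗d (suc k)) n x))

evalSeq-+ : ∀ c d n x → evalSeq (λ k → c k + d k) n x ≡ evalSeq c n x + evalSeq d n x
evalSeq-+ c d zero    x = refl
evalSeq-+ c d (suc n) x = begin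
  (c 0 + d 0) + x * evalSeq (λ k → c (suc k) + d (suc k)) n x
    ≡⟨ cong (λ t → (c 0 + d 0) + x * t) (evalSeq-+ (λ k → c (suc k)) (λ k → d (suc k)) n x) ⟩
  (c 0 + d 0) + x * (evalSeq c′ n x + evalSeq d′ n x)
    ≡⟨ cong ((c 0 + d 0) +_) (*-distribˡ-+ x (evalSeq c′ n x) (evalSeq d′ n x)) ⟩
  (c 0 + d 0) + (x * evalSeq c′ n x + x * evalSeq d′ n x)
    ≡⟨ interchange (c 0) (d 0) _ _ ⟩
  (c 0 + x * evalSeq c′ n x) + (d 0 + x * evalSeq d′ n x) ∎
  where
  open ≡-Reasoning
  c′ d′ : ℕ → ℕ
  c′ k = c (suc k)
  d′ k = d (suc k)

evalSeq-vanish : ∀ c n x → (∀ k → n ≤ k → c k ≡ 0) → evalSeq c (suc n) x ≡ evalSeq c n x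
evalSeq-vanish c zero    x c≡0 rewrite c≡0 0 z≤n | *-zeroʳ x = refl
evalSeq-vanish c (suc n) x c≡0 =
  cong (λ t → c 0 + x * t) (evalSeq-vanish (λ k → c (suc k)) n x (λ k n≤k → c≡0 (suc k) (s≤s n≤k)))

evalPoly-map-applyUpTo : ∀ (f g : ℕ → ℕ) n x → evalPoly (map f (applyUpTo g n)) x ≡ evalSeq (λ k → f (g k)) n x
evalPoly-map-applyUpTo f g zero    x = refl
evalPoly-map-applyUpTo f g (suc n) x = cong (λ t → f (g 0) + x * t) (evalPoly-map-applyUpTo f (λ k → g (suc k)) n x)

Φ : List Letter → ℕ → ℕ
Φ []      x = 0
Φ (S ∷ w) x = 1 + suc x * Φ w x
Φ (D ∷ w) x = 1 + Φ w x

evalPoly-bVecAux : ∀ {w} → EndsWithS w → ∀ acc x → evalPoly (bVecAux acc w) (suc x) ≡ acc + Φ w x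
evalPoly-bVecAux [S]    acc x = sym (+-suc acc _)
evalPoly-bVecAux (S∷ e) acc x =
  trans (cong (λ t → suc acc + suc x * t) (evalPoly-bVecAux e 0 x)) (sym (+-suc acc _))
evalPoly-bVecAux (D∷ e) acc x = trans (evalPoly-bVecAux e (suc acc) x) (sym (+-suc acc _))

evalSeq-cliques : ∀ {w} → EndsWithS w → ∀ x → evalSeq (λ k → cliques w (suc k)) (numS w) x ≡ Φ w x
evalSeq-cliques [S]          x = refl
evalSeq-cliques (S∷_ {w} e)  x = begin
  evalSeq (λ k → cliques (S ∷ w) (suc k)) (suc n) x
    ≡⟨ evalSeq-cong (cliques-S∷ w) (suc n) x ⟩
  evalSeq (λ k → cliques w k + c k) (suc n) x
    ≡⟨ evalSeq-+ (cliques w) c (suc n) x ⟩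
  (cliques w 0 + x * evalSeq c n x) + evalSeq c (suc n) x
    ≡⟨ cong₂ (λ a b → (a + x * evalSeq c n x) + b) (cliques-zero w) (evalSeq-vanish c n x (cliques-vanish e)) ⟩
  suc (x * evalSeq c n x + evalSeq c n x)
    ≡⟨ cong (λ t → suc (x * t + t)) (evalSeq-cliques e x) ⟩
  suc (x * Φ w x + Φ w x)
    ≡⟨ cong suc (+-comm (x * Φ w x) (Φ w x)) ⟩
  Φ (S ∷ w) x ∎
  where
  open ≡-Reasoning
  n = numS w
  c : ℕ → ℕ
  c k = cliques w (suc k)
evalSeq-cliques (D∷_ {w} e) x with numS w | numS-positive e | evalSeq-cliques e x
... | suc n | _ | ih = trans
  (cong₂ _+_ (cliques-D∷ w 0) (cong (x *_) (evalSeq-cong (λ k → cliques-D∷ w (suc k)) n x)))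
  (cong suc ih)

proposition2p2 : (w : List Letter) → last w ≡ just S → (x : ℕ) →
    evalPoly (bVec w) (suc x) ≡ evalPoly (cliqueVec w) x
proposition2p2 w last≡S x = begin
  evalPoly (bVec w) (suc x)                                       ≡⟨ evalPoly-bVecAux e 0 x ⟩
  Φ w x                                                           ≡⟨ evalSeq-cliques e x ⟨
  evalSeq (λ k → cliques w (suc k)) (numS w) x                    ≡⟨ evalSeq-cong count≡ (numS w) x ⟨
  evalSeq (λ k → cliqueCount (thresholdGraph w) (suc k)) (numS w) x
    ≡⟨ evalPoly-map-applyUpTo (λ k → cliqueCount (thresholdGraph w) (suc k)) (λ k → k) (numS w) x ⟨
  evalPoly (cliqueVec w) x ∎
  where
  open ≡-Reasoning
  e : EndsWithS w
  e = last≡S⇒EndsWithS w last≡S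
  count≡ : ∀ k → cliqueCount (thresholdGraph w) (suc k) ≡ cliques w (suc k)
  count≡ k = length-filterᵇ _ (allSubsets (length w))
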